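{- For every $\sigma\in\mathfrak{S}_n$, $\mathsf{Inv}(\sigma)=\mathsf{Sor}(\phi(\sigma))$, where $\phi=B^{ -1}\circ A$.
   Context: $\mathfrak{S}_n$ is the symmetric group on $[n]$, permutations in one-line notation $\sigma=\sigma_1\cdots\sigma_n$. Lehmer code: $\mathsf{Leh}(\sigma)=(\ell_1,\dots,\ell_n)$, $\ell_i=\#\{j\le i:\sigma_j\le\sigma_i\}$, a bijection onto $\mathcal{L}_n=\{(\ell_1,\dots,\ell_n):1\le\ell_i\le i\}$. $A(\sigma)=\mathsf{Leh}(\sigma^{ -1})$. $B(\sigma)=(b_1,\dots,b_n)$ with $b_i=\sigma^{ -k_i}(i)$, $k_i\ge1$ smallest with $\sigma^{ -k_i}(i)\le i$; $B:\mathfrak{S}_n\to\mathcal{L}_n$ is a bijection. Induced set $\langle(\ell_1,\dots,\ell_n)\rangle$: start with $S=[n]$, $U=\emptyset$; for $i=n,\dots,1$: let $\ell_i'$ be the $\ell_i$-th smallest element of $S$, add to $U$ all pairs $(\ell_i',j)$ with $j\in S$, $j>\ell_i'$, then delete $\ell_i'$ from $S$; output $U$. $\mathsf{Inv}(\sigma)=\{(i,j):i<j,\ \sigma_i>\sigma_j\}$ and $\mathsf{Sor}(\sigma)=\langle B(\sigma)\rangle$. -}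

module Defs where

open import Data.Nat using (ℕ; zero; suc)
open import Data.Bool using (Bool; true; false; if_then_else_)
open import Data.Fin using (Fin; toℕ; _<_; _≟_)
open import Data.Fin.Properties using (_≤?_; _<?_)
open import Data.Fin.Permutation using (Permutation′; _⟨$⟩ʳ_; _⟨$⟩ˡ_; flip)
open import Data.List using (List; []; _∷_; filter; length; map; reverse; _++_)
open import Data.List.Membership.Propositional using (_∈_)
open import Data.Product using (_×_; _,_)
open import Data.Maybe using (Maybe; just; nothing)
open import Relation.Nullary using (¬?; does)
open import Relation.Nullary.Decidable using (_×-dec_)
open import Data.List.Base using (allFin)

-- Conventions: [n] is modelled by Fin n (element k of [n] is the Fin with toℕ = k-1).
-- A permutation σ ∈ 𝔖_n is a Permutation′ n; σ_i is  σ ⟨$⟩ʳ i.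
-- A code (ℓ_1,…,ℓ_n) is a function  Fin n → ℕ , with the value at position i
-- (toℕ i = paper-index - 1) being the paper's ℓ (1-based, so 1 ≤ ℓ ≤ toℕ i + 1 on 𝓛_n).

Code : ℕ → Set
Code n = Fin n → ℕ

Leh : ∀ {n} → Permutation′ n → Code n
Leh {n} σ i = length (filter (λ j → (j ≤? i) ×-dec ((σ ⟨$⟩ʳ j) ≤? (σ ⟨$⟩ʳ i))) (allFin n))

A : ∀ {n} → Permutation′ n → Code n
A σ = Leh (flip σ)

-- B(σ)_i = σ^{-k}(i) for the least k ≥ 1 with σ^{-k}(i) ≤ i.
-- Search by iterating σ⁻¹ from i; the fuel n suffices since the cycle of i
-- has length ≤ n (and σ^{-len}(i) = i ≤ i).  Value stored 1-based.
Bsearch : ∀ {n} → Permutation′ n → Fin n → ℕ → Fin n → Fin n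
Bsearch σ i zero x = i
Bsearch σ i (suc fuel) x with (σ ⟨$⟩ˡ x) ≤? i
... | Relation.Nullary.yes _ = σ ⟨$⟩ˡ x
... | Relation.Nullary.no _ = Bsearch σ i fuel (σ ⟨$⟩ˡ x)

B : ∀ {n} → Permutation′ n → Code n
B {n} σ i = suc (toℕ (Bsearch σ i n i))

-- k-th smallest (1-based k) element of a list (lists here are kept increasing)
nth1 : ∀ {a} {X : Set a} → List X → ℕ → Maybe X
nth1 [] k = nothing
nth1 (x ∷ xs) zero = nothing
nth1 (x ∷ xs) (suc zero) = just x
nth1 (x ∷ xs) (suc (suc k)) = nth1 xs (suc k)

-- Induced set ⟨ℓ⟩, as a list of pairs.  Processes positions in the given order
-- (we pass n,…,1), with S the current (increasing) list of remaining elements.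
inducedGo : ∀ {n} → Code n → List (Fin n) → List (Fin n) → List (Fin n × Fin n)
inducedGo ℓ [] S = []
inducedGo ℓ (i ∷ is) S with nth1 S (ℓ i)
... | nothing = inducedGo ℓ is S
... | just l′ = map (λ j → l′ , j) (filter (λ j → l′ <? j) S)
                 ++ inducedGo ℓ is (filter (λ j → ¬? (j ≟ l′)) S)

induced : ∀ {n} → Code n → List (Fin n × Fin n)
induced {n} ℓ = inducedGo ℓ (reverse (allFin n)) (allFin n)

Inv : ∀ {n} → Permutation′ n → Fin n → Fin n → Set
Inv σ i j = i < j × (σ ⟨$⟩ʳ j) < (σ ⟨$⟩ʳ i)

Sor : ∀ {n} → Permutation′ n → List (Fin n × Fin n)
Sor σ = induced (B σ)

-- Write Sₖ = σ⁻¹{1,…,k}.  The k-th entry of A σ counts the j ≤ k with σ⁻¹ j ≤ σ⁻¹ k, i.e. it is the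
-- rank of σ⁻¹ k in Sₖ.  So when ⟨A σ⟩ is built from position n down to 1, the current set is Sₖ, the
-- chosen element is σ⁻¹ k, and the pairs added are (σ⁻¹ k, j) with j > σ⁻¹ k and σ j < k: exactly the
-- inversions of σ whose larger value is k.  As Sor τ = ⟨B τ⟩ = ⟨A σ⟩ whenever B τ = A σ, this is Inv σ.
-- Such a τ exists because B maps onto 𝓛ₙ, by induction on n: if B τ = (ℓ₁,…,ℓₙ), splicing n+1 into the
-- cycles of τ⁻¹ just before ℓₙ₊₁ keeps every first return below n+1 and makes n+1 return to ℓₙ₊₁.

module Submission where

open import Defs
open import Level using (Level; 0ℓ)
open import Data.Nat as ℕ using (ℕ; zero; suc; z≤n; s≤s; _+_; _∸_)
import Data.Nat.Properties as ℕₚ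
open import Data.Nat.GeneralisedArithmetic using (iterate)
open import Data.Fin as Fin using (Fin; toℕ; fromℕ; fromℕ<; inject₁; punchIn; _≤_; _<_; _≟_)
open import Data.Fin.Properties
  using (_≤?_; _<?_; toℕ-injective; toℕ<n; toℕ-fromℕ; toℕ-fromℕ<; toℕ-inject₁; inject₁ℕ<; ≤fromℕ; fromℕ≢inject₁; pigeonhole)
open import Data.Fin.Permutation
  using (Permutation′; _⟨$⟩ʳ_; _⟨$⟩ˡ_; flip; id; insert; insert-punchIn; transpose; _∘ₚ_; inverseˡ; inverseʳ)
import Data.Fin.Permutation.Components as PC
open import Data.Fin.Relation.Unary.Top using (View; view; ‵fromℕ; ‵inject₁)
open import Data.List using (List; []; _∷_; filter; length; map; tabulate; allFin; _++_; reverse; reverseAcc)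
open import Data.List.Properties using (length-map; length-tabulate; length-filter; filter-accept; filter-reject; filter-none; filter-some; filter-all; filter-≐)
open import Data.List.Membership.Propositional using (_∈_; lose)
open import Data.List.Membership.Propositional.Properties
  using (∈-filter⁺; ∈-filter⁻; ∈-map⁺; ∈-map⁻; ++-∈⇔; ∈-allFin)
open import Data.List.Membership.Propositional.Properties.WithK using (unique∧set⇒bag)
open import Data.List.Relation.Binary.BagAndSetEquality using (∼bag⇒↭)
open import Data.List.Relation.Binary.Permutation.Propositional.Properties using (↭-length)
import Data.List.Relation.Unary.All as All
open import Data.List.Relation.Unary.Any using (here; there)
open import Data.List.Relation.Unary.AllPairs using (AllPairs; _∷_)
import Data.List.Relation.Unary.AllPairs.Properties as AllPairs
import Data.List.Relation.Unary.Unique.Propositional.Properties as Unique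
open import Data.Product using (_×_; _,_; ∃; Σ; proj₁; proj₂)
open import Data.Sum using (_⊎_; inj₁; inj₂)
open import Data.Sum.Function.Propositional using (_⊎-⇔_)
open import Data.Maybe using (just; nothing)
open import Function using (_∘_)
open import Function.Bundles using (_⇔_; mk⇔; Equivalence; Injection)
open import Function.Definitions using (Injective)
import Function.Properties.Equivalence as ⇔
open import Function.Properties.Inverse using (↔⇒↣)
open import Relation.Nullary using (¬_; ¬?; yes; no; contradiction)
open import Relation.Nullary.Decidable using (_×-dec_; dec-true; dec-false)
open import Relation.Unary using (Pred; Decidable)
open import Relation.Binary.PropositionalEquality
import Relation.Binary.Reasoning.Setoid as SetoidReasoning

private variable
  a p q : Level
  X : Set a
  m n : ℕ


filter-filter : {P : Pred X p} {Q : Pred X q} (P? : Decidable P) (Q? : Decidable Q) → ∀ xs →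
  filter P? (filter Q? xs) ≡ filter (λ x → Q? x ×-dec P? x) xs
filter-filter P? Q? [] = refl
filter-filter P? Q? (x ∷ xs) with Q? x
... | no _ = filter-filter P? Q? xs
... | yes _ with P? x
...   | yes _ = cong (x ∷_) (filter-filter P? Q? xs)
...   | no _ = filter-filter P? Q? xs

∈-map-pair : ∀ {Y : Set a} {l x : X} {y : Y} {ys} → (x , y) ∈ map (l ,_) ys ⇔ (x ≡ l × y ∈ ys)
∈-map-pair {l = l} = mk⇔ to from
  where
  to : ∀ {x y ys} → (x , y) ∈ map (l ,_) ys → x ≡ l × y ∈ ys
  to m with ∈-map⁻ (l ,_) m
  ... | _ , y∈ , refl = refl , y∈

  from : ∀ {x y ys} → x ≡ l × y ∈ ys → (x , y) ∈ map (l ,_) ys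
  from (refl , y∈) = ∈-map⁺ (l ,_) y∈

nth1-rank : ∀ {xs : List (Fin n)} {x} → AllPairs _<_ xs → x ∈ xs → nth1 xs (length (filter (_≤? x) xs)) ≡ just x
nth1-rank {xs = x ∷ ys} (x<ys ∷ _) (here refl)
  rewrite filter-accept (_≤? x) {xs = ys} (ℕₚ.≤-refl {toℕ x})
        | filter-none (_≤? x) (All.map ℕₚ.<⇒≱ x<ys) = refl
nth1-rank {xs = y ∷ ys} {x} (y<ys ∷ sorted) (there x∈ys)
  rewrite filter-accept (_≤? x) {xs = ys} (ℕₚ.<⇒≤ (All.lookup y<ys x∈ys))
  with length (filter (_≤? x) ys) | filter-some (_≤? x) (lose x∈ys (ℕₚ.≤-refl {toℕ x})) | nth1-rank sorted x∈ys
... | suc _ | _ | rank = rank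

length-filter-reindex : ∀ (σ : Permutation′ n) {P : Pred (Fin n) p} {Q : Pred (Fin n) q}
  (P? : Decidable P) (Q? : Decidable Q) → (∀ y → P (σ ⟨$⟩ʳ y) ⇔ Q y) →
  length (filter P? (allFin n)) ≡ length (filter Q? (allFin n))
length-filter-reindex {n} σ {P} P? Q? P∘σ⇔Q = begin
  length (filter P? (allFin n))                  ≡⟨ ↭-length (∼bag⇒↭ (unique∧set⇒bag uniqueP uniqueσQ sameElems)) ⟩
  length (map (σ ⟨$⟩ʳ_) (filter Q? (allFin n)))  ≡⟨ length-map (σ ⟨$⟩ʳ_) (filter Q? (allFin n)) ⟩
  length (filter Q? (allFin n))                  ∎
  where
  open ≡-Reasoning
  uniqueP = Unique.filter⁺ P? (Unique.allFin⁺ n)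
  uniqueσQ = Unique.map⁺ (Injection.injective (↔⇒↣ σ)) (Unique.filter⁺ Q? (Unique.allFin⁺ n))
  sameElems : ∀ {x} → x ∈ filter P? (allFin n) ⇔ x ∈ map (σ ⟨$⟩ʳ_) (filter Q? (allFin n))
  sameElems {x} = mk⇔ to from
    where
    to : x ∈ filter P? (allFin n) → x ∈ map (σ ⟨$⟩ʳ_) (filter Q? (allFin n))
    to x∈ = subst (_∈ _) (inverseʳ σ) (∈-map⁺ (σ ⟨$⟩ʳ_) (∈-filter⁺ Q? {xs = allFin n} (∈-allFin _)
              (Equivalence.to (P∘σ⇔Q _) (subst P (sym (inverseʳ σ)) (proj₂ (∈-filter⁻ P? {xs = allFin n} x∈))))))
    from : x ∈ map (σ ⟨$⟩ʳ_) (filter Q? (allFin n)) → x ∈ filter P? (allFin n)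
    from x∈ with ∈-map⁻ (σ ⟨$⟩ʳ_) x∈
    ... | y , y∈ , refl = ∈-filter⁺ P? {xs = allFin n} (∈-allFin _) (Equivalence.from (P∘σ⇔Q y) (proj₂ (∈-filter⁻ Q? {xs = allFin n} y∈)))

data CountingUp {n} : ℕ → List (Fin n) → Set where
  []  : ∀ {k} → CountingUp k []
  _∷_ : ∀ {k x xs} → toℕ x ≡ k → CountingUp (suc k) xs → CountingUp k (x ∷ xs)

data CountingDown {n} : ℕ → List (Fin n) → Set where
  []  : CountingDown 0 []
  _∷_ : ∀ {k p ps} → toℕ p ≡ k → CountingDown k ps → CountingDown (suc k) (p ∷ ps)

countingUp-tabulate : ∀ k (f : Fin m → Fin n) → (∀ j → toℕ (f j) ≡ k + toℕ j) → CountingUp k (tabulate f)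
countingUp-tabulate {zero} k f f≗k+ = []
countingUp-tabulate {suc m} k f f≗k+ =
  trans (f≗k+ Fin.zero) (ℕₚ.+-identityʳ k) ∷
  countingUp-tabulate (suc k) (f ∘ Fin.suc) (λ j → trans (f≗k+ (Fin.suc j)) (ℕₚ.+-suc k (toℕ j)))

countingUp-allFin : ∀ n → CountingUp 0 (allFin n)
countingUp-allFin n = countingUp-tabulate 0 (λ i → i) (λ _ → refl)

countingDown-reverseAcc : ∀ {k} {acc xs : List (Fin n)} → CountingDown k acc → CountingUp k xs →
  CountingDown (k + length xs) (reverseAcc acc xs)
countingDown-reverseAcc {k = k} {acc} down [] = subst (λ t → CountingDown t acc) (sym (ℕₚ.+-identityʳ k)) down
countingDown-reverseAcc {n} {k} {acc} {x ∷ xs} down (e ∷ up) =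
  subst (λ t → CountingDown {n} t (reverseAcc (x ∷ acc) xs)) (sym (ℕₚ.+-suc k (length xs)))
    (countingDown-reverseAcc (e ∷ down) up)

countingDown-reverse-allFin : ∀ n → CountingDown n (reverse (allFin n))
countingDown-reverse-allFin n =
  subst (λ t → CountingDown t (reverse (allFin n))) (length-tabulate (λ i → i)) (countingDown-reverseAcc [] (countingUp-allFin n))

length-filter-≤-countingUp : ∀ (i : Fin n) {k} {xs : List (Fin n)} → CountingUp k xs → length (filter (_≤? i) xs) ℕ.≤ suc (toℕ i) ∸ k
length-filter-≤-countingUp i [] = z≤n
length-filter-≤-countingUp i {k} (_∷_ {x = x} {xs} refl up) with x ≤? i
... | yes x≤i rewrite filter-accept (_≤? i) {xs = xs} x≤i =
  subst (suc (length (filter (_≤? i) xs)) ℕ.≤_) (sym (ℕₚ.+-∸-assoc 1 x≤i)) (s≤s (length-filter-≤-countingUp i up))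
... | no x≰i rewrite filter-reject (_≤? i) {xs = xs} x≰i =
  ℕₚ.≤-trans (length-filter-≤-countingUp i up) (ℕₚ.∸-monoʳ-≤ (suc (toℕ i)) (ℕₚ.n≤1+n k))

-- First returns and the code B

data FirstAtMost {n} (g : Fin n → Fin n) (i : Fin n) : Fin n → Fin n → Set where
  here  : ∀ {z} → z ≤ i → FirstAtMost g i z z
  there : ∀ {z y} → ¬ z ≤ i → FirstAtMost g i (g z) y → FirstAtMost g i z y

steps : ∀ {g : Fin n → Fin n} {i z y} → FirstAtMost g i z y → ℕ
steps (here _) = 0
steps (there _ walk) = suc (steps walk)

FirstAtMost-functional : ∀ {g : Fin n → Fin n} {i z y y′} → FirstAtMost g i z y → FirstAtMost g i z y′ → y ≡ y′
FirstAtMost-functional (here _) (here _) = refl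
FirstAtMost-functional (here z≤i) (there z≰i _) = contradiction z≤i z≰i
FirstAtMost-functional (there z≰i _) (here z≤i) = contradiction z≤i z≰i
FirstAtMost-functional (there _ walk) (there _ walk′) = FirstAtMost-functional walk walk′

FirstAtMost-iterate : ∀ {g : Fin n → Fin n} {i} d z → iterate g z d ≤ i →
  ∃ λ y → Σ (FirstAtMost g i z y) λ walk → steps walk ℕ.≤ d
FirstAtMost-iterate zero z z≤i = z , here z≤i , z≤n
FirstAtMost-iterate {i = i} (suc d) z gᵈz≤i with z ≤? i
... | yes z≤i = z , here z≤i , z≤n
... | no z≰i with FirstAtMost-iterate d _ gᵈz≤i
...   | y , walk , walk≤d = y , there z≰i walk , s≤s walk≤d

iterate-+ : ∀ (g : X → X) d e x → iterate g x (d + e) ≡ iterate g (iterate g x d) e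
iterate-+ g zero e x = refl
iterate-+ g (suc d) e x = iterate-+ g d e (g x)

iterate-injective : ∀ {g : X → X} → Injective _≡_ _≡_ g → ∀ d → Injective _≡_ _≡_ (λ x → iterate g x d)
iterate-injective g-inj zero e = e
iterate-injective g-inj (suc d) e = g-inj (iterate-injective g-inj d e)

-- Pigeonhole on i, g i, …, gⁿ i, then cancel the common prefix of the two equal iterates.
iterate-returns : ∀ {g : Fin n → Fin n} → Injective _≡_ _≡_ g → ∀ i → ∃ λ d → d ℕ.< n × iterate g i (suc d) ≡ i
iterate-returns {n} {g} g-inj i with pigeonhole (ℕₚ.n<1+n n) (λ k → iterate g i (toℕ k))
... | a , b , a<b , gᵃ≡gᵇ = d , d<n , iterate-injective g-inj (toℕ a) (begin
  iterate g (iterate g i (suc d)) (toℕ a) ≡⟨ iterate-+ g (suc d) (toℕ a) i ⟨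
  iterate g i (suc d + toℕ a)             ≡⟨ cong (iterate g i) 1+d+a≡b ⟩
  iterate g i (toℕ b)                     ≡⟨ gᵃ≡gᵇ ⟨
  iterate g i (toℕ a)                     ∎)
  where
  open ≡-Reasoning
  d = toℕ b ∸ suc (toℕ a)
  1+d+a≡b : suc d + toℕ a ≡ toℕ b
  1+d+a≡b = trans (sym (ℕₚ.+-suc d (toℕ a))) (ℕₚ.m∸n+n≡m a<b)
  d<n : d ℕ.< n
  d<n = ℕₚ.≤-trans (ℕₚ.m≤m+n (suc d) (toℕ a)) (subst (ℕ._≤ n) (sym 1+d+a≡b) (ℕₚ.≤-pred (toℕ<n b)))

-- The walk defining B τ i is shorter than the fuel n given to Bsearch.
firstReturn : ∀ (τ : Permutation′ n) i → ∃ λ y → Σ (FirstAtMost (τ ⟨$⟩ˡ_) i (τ ⟨$⟩ˡ i) y) λ walk → steps walk ℕ.< n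
firstReturn τ i with iterate-returns (Injection.injective (↔⇒↣ (flip τ))) i
... | d , d<n , returns with FirstAtMost-iterate d (τ ⟨$⟩ˡ i) (subst (_≤ i) (sym returns) (ℕₚ.≤-refl {toℕ i}))
...   | y , walk , walk≤d = y , walk , ℕₚ.≤-<-trans walk≤d d<n

Bsearch-FirstAtMost : ∀ (τ : Permutation′ n) {i x y} fuel (walk : FirstAtMost (τ ⟨$⟩ˡ_) i (τ ⟨$⟩ˡ x) y) →
  steps walk ℕ.< fuel → Bsearch τ i fuel x ≡ y
Bsearch-FirstAtMost τ {i} {x} (suc fuel) walk steps<fuel with (τ ⟨$⟩ˡ x) ≤? i | walk
... | yes _   | here _ = refl
... | yes z≤i | there z≰i _ = contradiction z≤i z≰i
... | no z≰i  | here z≤i = contradiction z≤i z≰i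
... | no _    | there _ walk′ = Bsearch-FirstAtMost τ fuel walk′ (ℕₚ.≤-pred steps<fuel)

B-FirstAtMost : ∀ (τ : Permutation′ n) {i y} → FirstAtMost (τ ⟨$⟩ˡ_) i (τ ⟨$⟩ˡ i) y → B τ i ≡ suc (toℕ y)
B-FirstAtMost {n} τ {i} walk with firstReturn τ i
... | y′ , walk′ , walk′<n =
  cong (suc ∘ toℕ) (trans (Bsearch-FirstAtMost τ n walk′ walk′<n) (FirstAtMost-functional walk′ walk))

-- Every code in 𝓛ₙ is attained by B

inject₁-≤⇔ : ∀ {a b : Fin n} → inject₁ a ≤ inject₁ b ⇔ a ≤ b
inject₁-≤⇔ {a = a} {b} = mk⇔ (subst₂ ℕ._≤_ (toℕ-inject₁ a) (toℕ-inject₁ b)) (subst₂ ℕ._≤_ (sym (toℕ-inject₁ a)) (sym (toℕ-inject₁ b)))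

fromℕ≰inject₁ : ∀ {i : Fin n} → ¬ fromℕ n ≤ inject₁ i
fromℕ≰inject₁ {n} {i} = ℕₚ.<⇒≱ (subst (toℕ (inject₁ i) ℕ.<_) (sym (toℕ-fromℕ n)) (inject₁ℕ< i))

punchIn-fromℕ : ∀ (k : Fin n) → punchIn (fromℕ n) k ≡ inject₁ k
punchIn-fromℕ Fin.zero = refl
punchIn-fromℕ (Fin.suc k) = cong Fin.suc (punchIn-fromℕ k)

transpose-≡ˡ : ∀ (i j : Fin n) → PC.transpose i j i ≡ j
transpose-≡ˡ i j rewrite dec-true (i ≟ i) refl = refl

transpose-≡ʳ : ∀ {i j : Fin n} → j ≢ i → PC.transpose i j j ≡ i
transpose-≡ʳ {i = i} {j} j≢i rewrite dec-false (j ≟ i) j≢i | dec-true (j ≟ j) refl = refl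

transpose-≢ : ∀ {i j k : Fin n} → k ≢ i → k ≢ j → PC.transpose i j k ≡ k
transpose-≢ {i = i} {j} {k} k≢i k≢j rewrite dec-false (k ≟ i) k≢i | dec-false (k ≟ j) k≢j = refl

extend : Permutation′ n → Permutation′ (suc n)
extend {n} π = insert (fromℕ n) (fromℕ n) π

extend-fromℕ : ∀ (π : Permutation′ n) → extend π ⟨$⟩ʳ fromℕ n ≡ fromℕ n
extend-fromℕ {n} π with fromℕ n ≟ fromℕ n
... | yes _ = refl
... | no n≢n = contradiction refl n≢n

extend-inject₁ : ∀ (π : Permutation′ n) k → extend π ⟨$⟩ʳ inject₁ k ≡ inject₁ (π ⟨$⟩ʳ k)
extend-inject₁ {n} π k = begin
  extend π ⟨$⟩ʳ inject₁ k             ≡⟨ cong (extend π ⟨$⟩ʳ_) (punchIn-fromℕ k) ⟨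
  extend π ⟨$⟩ʳ punchIn (fromℕ n) k   ≡⟨ insert-punchIn (fromℕ n) (fromℕ n) π k ⟩
  punchIn (fromℕ n) (π ⟨$⟩ʳ k)        ≡⟨ punchIn-fromℕ (π ⟨$⟩ʳ k) ⟩
  inject₁ (π ⟨$⟩ʳ k)                  ∎
  where open ≡-Reasoning

-- The inverse of grow τ b sends the new point n to b and the τ⁻¹-preimage of b to n, otherwise agreeing with τ⁻¹.
grow : Permutation′ n → Fin (suc n) → Permutation′ (suc n)
grow {n} τ b = flip (extend (flip τ) ∘ₚ transpose (fromℕ n) b)

module _ (τ : Permutation′ n) (b : Fin (suc n)) where

  grow-fromℕ : grow τ b ⟨$⟩ˡ fromℕ n ≡ b
  grow-fromℕ = trans (cong (PC.transpose (fromℕ n) b) (extend-fromℕ (flip τ))) (transpose-≡ˡ (fromℕ n) b)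

  grow-inject₁ : ∀ x → grow τ b ⟨$⟩ˡ inject₁ x ≡ inject₁ (τ ⟨$⟩ˡ x)
                     ⊎ (grow τ b ⟨$⟩ˡ inject₁ x ≡ fromℕ n × inject₁ (τ ⟨$⟩ˡ x) ≡ b)
  grow-inject₁ x rewrite extend-inject₁ (flip τ) x with inject₁ (τ ⟨$⟩ˡ x) ≟ b
  ... | yes refl = inj₂ (transpose-≡ʳ (fromℕ≢inject₁ {i = τ ⟨$⟩ˡ x} ∘ sym) , refl)
  ... | no ≢b = inj₁ (transpose-≢ (fromℕ≢inject₁ ∘ sym) ≢b)

  -- In grow τ b, the step from z to τ⁻¹ z may pass through the new point n, which is never ≤ i.
  FirstAtMost-grow-step : ∀ {i z y} → FirstAtMost (grow τ b ⟨$⟩ˡ_) (inject₁ i) (inject₁ (τ ⟨$⟩ˡ z)) y →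
    FirstAtMost (grow τ b ⟨$⟩ˡ_) (inject₁ i) (grow τ b ⟨$⟩ˡ inject₁ z) y
  FirstAtMost-grow-step {i} {z} {y} walk with grow-inject₁ z
  ... | inj₁ direct = subst (λ w → FirstAtMost _ (inject₁ i) w y) (sym direct) walk
  ... | inj₂ (via-top , ≡b) = subst (λ w → FirstAtMost _ (inject₁ i) w y) (sym via-top)
          (there fromℕ≰inject₁ (subst (λ w → FirstAtMost _ (inject₁ i) w y) (trans ≡b (sym grow-fromℕ)) walk))

  FirstAtMost-grow : ∀ {i z y} → FirstAtMost (τ ⟨$⟩ˡ_) i z y →
    FirstAtMost (grow τ b ⟨$⟩ˡ_) (inject₁ i) (inject₁ z) (inject₁ y)
  FirstAtMost-grow (here z≤i) = here (Equivalence.from inject₁-≤⇔ z≤i)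
  FirstAtMost-grow (there z≰i walk) = there (z≰i ∘ Equivalence.to inject₁-≤⇔) (FirstAtMost-grow-step (FirstAtMost-grow walk))

  B-grow-fromℕ : B (grow τ b) (fromℕ n) ≡ suc (toℕ b)
  B-grow-fromℕ = B-FirstAtMost (grow τ b) (subst (λ w → FirstAtMost (grow τ b ⟨$⟩ˡ_) (fromℕ n) w b) (sym grow-fromℕ) (here (≤fromℕ b)))

  B-grow-inject₁ : ∀ i → B (grow τ b) (inject₁ i) ≡ B τ i
  B-grow-inject₁ i with firstReturn τ i
  ... | y , walk , _ = begin
    B (grow τ b) (inject₁ i) ≡⟨ B-FirstAtMost (grow τ b) (FirstAtMost-grow-step (FirstAtMost-grow walk)) ⟩
    suc (toℕ (inject₁ y))    ≡⟨ cong suc (toℕ-inject₁ y) ⟩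
    suc (toℕ y)              ≡⟨ B-FirstAtMost τ walk ⟨
    B τ i                    ∎
    where open ≡-Reasoning

LehmerCode : Code n → Set
LehmerCode {n} c = ∀ i → 1 ℕ.≤ c i × c i ℕ.≤ suc (toℕ i)

suc-toℕ-onto : ∀ {v} → 1 ℕ.≤ v → v ℕ.≤ n → ∃ λ (b : Fin n) → suc (toℕ b) ≡ v
suc-toℕ-onto {v = suc k} _ k<n = fromℕ< k<n , cong suc (toℕ-fromℕ< k<n)

LehmerCode-inject₁ : ∀ {c : Code (suc n)} → LehmerCode c → LehmerCode (c ∘ inject₁)
LehmerCode-inject₁ {c = c} c-code i =
  proj₁ (c-code (inject₁ i)) , subst (λ t → c (inject₁ i) ℕ.≤ suc t) (toℕ-inject₁ i) (proj₂ (c-code (inject₁ i)))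

LehmerCode-fromℕ : ∀ {c : Code (suc n)} → LehmerCode c → ∃ λ (b : Fin (suc n)) → suc (toℕ b) ≡ c (fromℕ n)
LehmerCode-fromℕ {n} {c} c-code =
  suc-toℕ-onto (proj₁ (c-code (fromℕ n))) (subst (λ t → c (fromℕ n) ℕ.≤ suc t) (toℕ-fromℕ n) (proj₂ (c-code (fromℕ n))))

B-surjective : ∀ (c : Code n) → LehmerCode c → ∃ λ τ → ∀ i → B τ i ≡ c i
B-surjective {zero} c _ = id , λ ()
B-surjective {suc n} c c-code with B-surjective (c ∘ inject₁) (LehmerCode-inject₁ c-code) | LehmerCode-fromℕ c-code
... | τ , Bτ≗c | b , b≡ = grow τ b , λ i → B-grow-≗ i (view i)
  where
  B-grow-≗ : ∀ i → View i → B (grow τ b) i ≡ c i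
  B-grow-≗ .(fromℕ n) ‵fromℕ = trans (B-grow-fromℕ τ b) b≡
  B-grow-≗ .(inject₁ y) (‵inject₁ y) = trans (B-grow-inject₁ τ b y) (Bτ≗c y)

-- The induced set of A σ is Inv σ

inducedGo-cong : ∀ {ℓ ℓ′ : Code n} → (∀ i → ℓ i ≡ ℓ′ i) → ∀ ps S → inducedGo ℓ ps S ≡ inducedGo ℓ′ ps S
inducedGo-cong ℓ≗ℓ′ [] S = refl
inducedGo-cong {ℓ = ℓ} {ℓ′} ℓ≗ℓ′ (p ∷ ps) S with nth1 S (ℓ p) | nth1 S (ℓ′ p) | cong (nth1 S) (ℓ≗ℓ′ p)
... | nothing | .nothing  | refl = inducedGo-cong ℓ≗ℓ′ ps S
... | just l  | .(just l) | refl = cong (_ ++_) (inducedGo-cong ℓ≗ℓ′ ps _)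

induced-cong : ∀ {ℓ ℓ′ : Code n} → (∀ i → ℓ i ≡ ℓ′ i) → induced ℓ ≡ induced ℓ′
induced-cong {n} ℓ≗ℓ′ = inducedGo-cong ℓ≗ℓ′ (reverse (allFin n)) (allFin n)

inducedGo-just : ∀ {ℓ : Code n} {p ps S l} → nth1 S (ℓ p) ≡ just l →
  inducedGo ℓ (p ∷ ps) S ≡ map (l ,_) (filter (l <?_) S) ++ inducedGo ℓ ps (filter (λ j → ¬? (j ≟ l)) S)
inducedGo-just {ℓ = ℓ} {p} {S = S} nth≡l with nth1 S (ℓ p) | nth≡l
... | just _ | refl = refl

≡⊎<⇔<suc : ∀ {P : Set a} {m k} → ((P × m ≡ k) ⊎ (P × m ℕ.< k)) ⇔ (P × m ℕ.< suc k)
≡⊎<⇔<suc = mk⇔ to from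
  where
  to : ∀ {P : Set _} {m k} → (P × m ≡ k) ⊎ (P × m ℕ.< k) → P × m ℕ.< suc k
  to (inj₁ (x , refl)) = x , ℕₚ.n<1+n _
  to (inj₂ (x , m<k)) = x , ℕₚ.m<n⇒m<1+n m<k
  from : ∀ {P : Set _} {m k} → P × m ℕ.< suc k → (P × m ≡ k) ⊎ (P × m ℕ.< k)
  from (x , m<1+k) with ℕₚ.m<1+n⇒m<n∨m≡n m<1+k
  ... | inj₁ m<k = inj₂ (x , m<k)
  ... | inj₂ m≡k = inj₁ (x , m≡k)

⟨$⟩ʳ≡⇒≡⟨$⟩ˡ : ∀ (σ : Permutation′ n) {y p} → σ ⟨$⟩ʳ y ≡ p → y ≡ σ ⟨$⟩ˡ p
⟨$⟩ʳ≡⇒≡⟨$⟩ˡ σ σy≡p = trans (sym (inverseˡ σ)) (cong (σ ⟨$⟩ˡ_) σy≡p)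

module _ (σ : Permutation′ n) where

  -- The list S of the construction of ⟨A σ⟩ once the positions n-1, …, k (0-based) are processed.
  remaining : ℕ → List (Fin n)
  remaining k = filter (λ y → toℕ (σ ⟨$⟩ʳ y) ℕ.<? k) (allFin n)

  ∈-remaining : ∀ {k y} → y ∈ remaining k ⇔ toℕ (σ ⟨$⟩ʳ y) ℕ.< k
  ∈-remaining {k} = mk⇔ (proj₂ ∘ ∈-filter⁻ (λ y → toℕ (σ ⟨$⟩ʳ y) ℕ.<? k) {xs = allFin n}) (∈-filter⁺ _ (∈-allFin _))

  remaining-sorted : ∀ k → AllPairs _<_ (remaining k)
  remaining-sorted k = AllPairs.filter⁺ _ (AllPairs.tabulate⁺-< (λ i<j → i<j))

  remaining-all : remaining n ≡ allFin n
  remaining-all = filter-all _ (All.universal (λ y → toℕ<n (σ ⟨$⟩ʳ y)) (allFin n))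

  <suc∧≢⇒< : ∀ {y} p → toℕ (σ ⟨$⟩ʳ y) ℕ.< suc (toℕ p) → y ≢ σ ⟨$⟩ˡ p → toℕ (σ ⟨$⟩ʳ y) ℕ.< toℕ p
  <suc∧≢⇒< p σy<1+p y≢ = ℕₚ.≤∧≢⇒< (ℕₚ.≤-pred σy<1+p) (y≢ ∘ ⟨$⟩ʳ≡⇒≡⟨$⟩ˡ σ ∘ toℕ-injective)

  -- Leh counts over positions j ≤ p; reindexing by y = σ⁻¹ j turns this into the rank of σ⁻¹ p.
  A-rank : ∀ p → A σ p ≡ length (filter (_≤? σ ⟨$⟩ˡ p) (remaining (suc (toℕ p))))
  A-rank p = trans (length-filter-reindex σ _ _ (λ y → mk⇔ to from))
                   (cong length (sym (filter-filter (_≤? σ ⟨$⟩ˡ p) (λ y → toℕ (σ ⟨$⟩ʳ y) ℕ.<? suc (toℕ p)) (allFin n))))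
    where
    to : ∀ {y} → σ ⟨$⟩ʳ y ≤ p × σ ⟨$⟩ˡ (σ ⟨$⟩ʳ y) ≤ σ ⟨$⟩ˡ p → toℕ (σ ⟨$⟩ʳ y) ℕ.< suc (toℕ p) × y ≤ σ ⟨$⟩ˡ p
    to (σy≤p , y≤) = s≤s σy≤p , subst (_≤ σ ⟨$⟩ˡ p) (inverseˡ σ) y≤
    from : ∀ {y} → toℕ (σ ⟨$⟩ʳ y) ℕ.< suc (toℕ p) × y ≤ σ ⟨$⟩ˡ p → σ ⟨$⟩ʳ y ≤ p × σ ⟨$⟩ˡ (σ ⟨$⟩ʳ y) ≤ σ ⟨$⟩ˡ p
    from (σy<1+p , y≤) = ℕₚ.≤-pred σy<1+p , subst (_≤ σ ⟨$⟩ˡ p) (sym (inverseˡ σ)) y≤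

  nth1-A : ∀ p → nth1 (remaining (suc (toℕ p))) (A σ p) ≡ just (σ ⟨$⟩ˡ p)
  nth1-A p = trans (cong (nth1 (remaining (suc (toℕ p)))) (A-rank p)) (nth1-rank (remaining-sorted _)
    (Equivalence.from ∈-remaining (subst (λ t → toℕ t ℕ.< suc (toℕ p)) (sym (inverseʳ σ)) (ℕₚ.n<1+n (toℕ p)))))

  remaining-remove : ∀ p → filter (λ j → ¬? (j ≟ σ ⟨$⟩ˡ p)) (remaining (suc (toℕ p))) ≡ remaining (toℕ p)
  remaining-remove p = trans (filter-filter _ _ (allFin n)) (filter-≐ _ _ (to , from) (allFin n))
    where
    to : ∀ {y} → toℕ (σ ⟨$⟩ʳ y) ℕ.< suc (toℕ p) × y ≢ σ ⟨$⟩ˡ p → toℕ (σ ⟨$⟩ʳ y) ℕ.< toℕ p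
    to (σy<1+p , y≢) = <suc∧≢⇒< p σy<1+p y≢
    from : ∀ {y} → toℕ (σ ⟨$⟩ʳ y) ℕ.< toℕ p → toℕ (σ ⟨$⟩ʳ y) ℕ.< suc (toℕ p) × y ≢ σ ⟨$⟩ˡ p
    from σy<p = ℕₚ.m<n⇒m<1+n σy<p , λ { refl → ℕₚ.<-irrefl (cong toℕ (inverseʳ σ)) σy<p }

  pairs-at : ∀ p {a c} →
    (a , c) ∈ map (σ ⟨$⟩ˡ p ,_) (filter (σ ⟨$⟩ˡ p <?_) (remaining (suc (toℕ p))))
    ⇔ (Inv σ a c × toℕ (σ ⟨$⟩ʳ a) ≡ toℕ p)
  pairs-at p = ⇔.trans ∈-map-pair (mk⇔ to from)
    where
    l = σ ⟨$⟩ˡ p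
    to : ∀ {a c} → a ≡ l × c ∈ filter (l <?_) (remaining (suc (toℕ p))) → Inv σ a c × toℕ (σ ⟨$⟩ʳ a) ≡ toℕ p
    to (refl , c∈) with ∈-filter⁻ (l <?_) {xs = remaining _} c∈
    ... | c∈remaining , l<c = (l<c , σc<σl) , σl≡p
      where
      σl≡p = cong toℕ (inverseʳ σ)
      σc<σl = subst (toℕ (σ ⟨$⟩ʳ _) ℕ.<_) (sym σl≡p)
                (<suc∧≢⇒< p (Equivalence.to ∈-remaining c∈remaining) λ { refl → ℕₚ.<-irrefl refl l<c })
    from : ∀ {a c} → Inv σ a c × toℕ (σ ⟨$⟩ʳ a) ≡ toℕ p → a ≡ l × c ∈ filter (l <?_) (remaining (suc (toℕ p)))
    from ((a<c , σc<σa) , σa≡p) with ⟨$⟩ʳ≡⇒≡⟨$⟩ˡ σ (toℕ-injective σa≡p)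
    ... | refl = refl , ∈-filter⁺ (l <?_) (Equivalence.from ∈-remaining
                   (ℕₚ.<-trans σc<σa (subst (ℕ._< suc (toℕ p)) (sym σa≡p) (ℕₚ.n<1+n _)))) a<c

  inducedGo-remaining : ∀ {k ps} → CountingDown k ps → ∀ {a c} →
    (a , c) ∈ inducedGo (A σ) ps (remaining k) ⇔ (Inv σ a c × toℕ (σ ⟨$⟩ʳ a) ℕ.< k)
  inducedGo-remaining [] = mk⇔ (λ ()) (λ ())
  inducedGo-remaining (_∷_ {p = p} {ps} refl down) {a} {c} = begin
    (a , c) ∈ inducedGo (A σ) (p ∷ ps) (remaining (suc (toℕ p)))
      ≡⟨ cong ((a , c) ∈_) unfold ⟩
    (a , c) ∈ new ++ inducedGo (A σ) ps (remaining (toℕ p))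
      ≈⟨ ++-∈⇔ ⟩
    ((a , c) ∈ new ⊎ (a , c) ∈ inducedGo (A σ) ps (remaining (toℕ p)))
      ≈⟨ pairs-at p ⊎-⇔ inducedGo-remaining down ⟩
    ((Inv σ a c × toℕ (σ ⟨$⟩ʳ a) ≡ toℕ p) ⊎ (Inv σ a c × toℕ (σ ⟨$⟩ʳ a) ℕ.< toℕ p))
      ≈⟨ ≡⊎<⇔<suc ⟩
    (Inv σ a c × toℕ (σ ⟨$⟩ʳ a) ℕ.< suc (toℕ p))
      ∎
    where
    open SetoidReasoning (⇔.⇔-setoid 0ℓ)
    new = map (σ ⟨$⟩ˡ p ,_) (filter (σ ⟨$⟩ˡ p <?_) (remaining (suc (toℕ p))))
    unfold : inducedGo (A σ) (p ∷ ps) (remaining (suc (toℕ p))) ≡ new ++ inducedGo (A σ) ps (remaining (toℕ p))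
    unfold = trans (inducedGo-just {ps = ps} {S = remaining (suc (toℕ p))} (nth1-A p)) (cong (λ S → new ++ inducedGo (A σ) ps S) (remaining-remove p))

  Inv⇔∈induced-A : ∀ i j → Inv σ i j ⇔ ((i , j) ∈ induced (A σ))
  Inv⇔∈induced-A i j = begin
    Inv σ i j                                                      ≈⟨ mk⇔ (_, toℕ<n (σ ⟨$⟩ʳ i)) proj₁ ⟩
    (Inv σ i j × toℕ (σ ⟨$⟩ʳ i) ℕ.< n)                             ≈⟨ ⇔.sym (inducedGo-remaining (countingDown-reverse-allFin n)) ⟩
    (i , j) ∈ inducedGo (A σ) (reverse (allFin n)) (remaining n)   ≡⟨ cong (λ S → (i , j) ∈ inducedGo (A σ) (reverse (allFin n)) S) remaining-all ⟩
    (i , j) ∈ induced (A σ)                                        ∎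
    where open SetoidReasoning (⇔.⇔-setoid 0ℓ)

A-LehmerCode : ∀ (σ : Permutation′ n) → LehmerCode (A σ)
A-LehmerCode {n} σ i = filter-some R? (lose (∈-allFin i) (ℕₚ.≤-refl , ℕₚ.≤-refl)) , (begin
  A σ i                                                   ≡⟨ cong length (filter-filter (λ j → flip σ ⟨$⟩ʳ j ≤? flip σ ⟨$⟩ʳ i) (_≤? i) (allFin n)) ⟨
  length (filter _ (filter (_≤? i) (allFin n)))          ≤⟨ length-filter _ (filter (_≤? i) (allFin n)) ⟩
  length (filter (_≤? i) (allFin n))                     ≤⟨ length-filter-≤-countingUp i (countingUp-allFin n) ⟩
  suc (toℕ i)                                             ∎)
  where
  open ℕₚ.≤-Reasoning
  R? = λ j → (j ≤? i) ×-dec ((flip σ ⟨$⟩ʳ j) ≤? (flip σ ⟨$⟩ʳ i))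

lemma2p6 : ∀ (n : ℕ) (σ : Permutation′ n) →
    (∃ λ (τ : Permutation′ n) → ∀ i → B τ i ≡ A σ i)
    × (∀ (τ : Permutation′ n) → (∀ i → B τ i ≡ A σ i) →
         ∀ (i j : Fin n) → Inv σ i j ⇔ ((i , j) ∈ Sor τ))
lemma2p6 n σ = B-surjective (A σ) (A-LehmerCode σ) , Inv⇔∈Sor
  where
  Inv⇔∈Sor : ∀ τ → (∀ i → B τ i ≡ A σ i) → ∀ i j → Inv σ i j ⇔ ((i , j) ∈ Sor τ)
  Inv⇔∈Sor τ Bτ≗Aσ i j = subst (λ U → Inv σ i j ⇔ ((i , j) ∈ U)) (induced-cong (sym ∘ Bτ≗Aσ)) (Inv⇔∈induced-A σ i j)
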